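{- Let $H$ be a digraph (possibly with loops), $D$ an $H$-colored digraph and $\mathscr{F}$ a non-trivial walk-preservative $H$-class partition of $A(D)$ such that $C_{\mathscr{F}}(D)$ has no sinks. If $\mathcal{S}$ is an independent set in $C_{\mathscr{F}}(D)$, then there exists a kernel by paths $N$ in $D\langle\bigcup_{F\in\mathcal{S}}F\rangle$ such that $N\subseteq V(D\langle\bigcup_{G\in N^{+}(\mathcal{S})}G\rangle)$.
   Context: An $H$-colored digraph is a finite digraph $D$ without loops with a coloring $\rho:A(D)\to V(H)$. For $F\subseteq A(D)$, $D\langle F\rangle$ is the digraph with arc set $F$ and vertex set the vertices incident with an arc of $F$. An $H$-class partition of $A(D)$ is a partition $\mathscr{F}$ of $A(D)$ such that for all arcs $(u,v),(v,w)$ of $D$, $(\rho(u,v),\rho(v,w))\in A(H)$ iff some $F\in\mathscr{F}$ contains both arcs. The $H$-class digraph $C_{\mathscr{F}}(D)$ has vertex set $\mathscr{F}$, and $(F,G)$ (possibly a loop) is an arc iff there exist $(u,v)\in F$ and $(v,w)\in G$. $\mathscr{F}$ is walk-preservative if for every arc $(F,G)$ of $C_{\mathscr{F}}(D)$ and every $z\in V(D\langle F\rangle)$ there is a $zw$-path in $D\langle F\rangle$ for some $w\in V(D\langle G\rangle)$. In a digraph possibly with loops, a sink is a vertex whose only possible out-going arc is a loop. A set is independent if there is no arc between two different of its vertices. $N^+(\mathcal{S})$ is the proper out-neighborhood of $\mathcal{S}$ in $C_{\mathscr{F}}(D)$ (vertices not in $\mathcal{S}$ receiving an arc from $\mathcal{S}$).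 A kernel by paths in a digraph is a vertex set $K$ such that there is no path between two different vertices of $K$ and every vertex not in $K$ has a path to a vertex of $K$. -}

module Defs where

open import Data.Nat using (ℕ; _≤_)
open import Data.Fin using (Fin)
open import Data.Bool using (Bool; true; false)
open import Data.List using (List; []; _∷_)
open import Data.List.Relation.Unary.Unique.Propositional using (Unique)
open import Data.Product using (Σ; ∃; _×_; _,_)
open import Data.Sum using (_⊎_)
open import Relation.Binary.PropositionalEquality using (_≡_; _≢_)
open import Relation.Nullary using (¬_)

ArcSet : ℕ → Set₁
ArcSet n = Fin n → Fin n → Set

IsArc : {n : ℕ} → (Fin n → Fin n → Bool) → ArcSet n
IsArc adj u v = adj u v ≡ true

-- V(D⟨F⟩): vertices incident with an arc of F.
InV : {n : ℕ} → ArcSet n → Fin n → Set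
InV A v = ∃ λ w → A v w ⊎ A w v

data PathSeq {n : ℕ} (A : ArcSet n) : Fin n → Fin n → List (Fin n) → Set where
  here : ∀ x → PathSeq A x x (x ∷ [])
  step : ∀ {x y z vs} → A x y → PathSeq A y z vs → PathSeq A x z (x ∷ vs)

Path : {n : ℕ} → ArcSet n → Fin n → Fin n → Set
Path {n} A x y = Σ (List (Fin n)) λ vs → PathSeq A x y vs × Unique vs

-- K is a kernel by paths in D⟨A⟩ (vertex set V(D⟨A⟩), arcs A).
IsKernelByPaths : {n : ℕ} → ArcSet n → (Fin n → Bool) → Set
IsKernelByPaths A K =
  (∀ v → K v ≡ true → InV A v)
  × (∀ x y → K x ≡ true → K y ≡ true → x ≢ y → ¬ Path A x y)
  × (∀ v → InV A v → K v ≡ false → ∃ λ w → K w ≡ true × Path A v w)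

module _ {n h m : ℕ}
         (adj : Fin n → Fin n → Bool)
         (Hadj : Fin h → Fin h → Bool)
         (ρ : Fin n → Fin n → Fin h)         -- coloring (only values on arcs matter)
         (cls : Fin n → Fin n → Fin m)       -- partition: arc (u,v) lies in class cls u v
         where

  -- every class index is used, i.e. classes of the partition are nonempty
  IsPartitionIndexing : Set
  IsPartitionIndexing = ∀ i → ∃ λ u → ∃ λ v → IsArc adj u v × cls u v ≡ i

  IsHClassPartition : Set
  IsHClassPartition =
    IsPartitionIndexing
    × (∀ u v w → IsArc adj u v → IsArc adj v w →
         (Hadj (ρ u v) (ρ v w) ≡ true → cls u v ≡ cls v w)
         × (cls u v ≡ cls v w → Hadj (ρ u v) (ρ v w) ≡ true))

  ClassArcs : Fin m → ArcSet n
  ClassArcs i u v = IsArc adj u v × cls u v ≡ i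

  -- arcs (possibly loops) of the H-class digraph C_F(D)
  CArc : Fin m → Fin m → Set
  CArc i j = ∃ λ u → ∃ λ v → ∃ λ w →
    ClassArcs i u v × ClassArcs j v w

  WalkPreservative : Set
  WalkPreservative = ∀ i j → CArc i j → ∀ z → InV (ClassArcs i) z →
    ∃ λ w → InV (ClassArcs j) w × Path (ClassArcs i) z w

  -- a sink: its only possible out-going arc is a loop
  IsSink : Fin m → Set
  IsSink i = ∀ j → CArc i j → i ≡ j

  Independent : (Fin m → Bool) → Set
  Independent S = ∀ i j → S i ≡ true → S j ≡ true → i ≢ j → ¬ CArc i j

  InOutNbhd : (Fin m → Bool) → Fin m → Set
  InOutNbhd S j = S j ≡ false × ∃ λ i → S i ≡ true × CArc i j

  UnionArcs : (Fin m → Bool) → ArcSet n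
  UnionArcs S u v = IsArc adj u v × S (cls u v) ≡ true

  NbhdUnionArcs : (Fin m → Bool) → ArcSet n
  NbhdUnionArcs S u v = IsArc adj u v × InOutNbhd S (cls u v)

{-# OPTIONS --safe #-}
module Submission where

-- In a finite digraph D⟨A⟩ in which every vertex has a path into a set g, take the least vertex
-- of g in every terminal strong component: paths from a terminal component stay inside it, so such
-- a vertex exists, no path joins two chosen vertices, and every vertex reaches some terminal
-- component and hence its chosen vertex. For A = ⋃ S and g = V(D⟨⋃ N⁺(S)⟩) the hypothesis holds:
-- the class F ∈ S of an arc at v has, not being a sink, a proper out-neighbour G in C_F(D); G ∉ S
-- by independence, and walk-preservation gives a path inside F from v to V(D⟨G⟩).

open import Defs
open import Data.Nat using (ℕ; _≤_; zero; suc; z≤n; s≤s)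
open import Data.Nat.Properties using (m≤n⇒m≤1+n)
open import Data.Fin using (Fin; _≟_) renaming (zero to fzero; suc to fsuc; _≤_ to _≤ᶠ_; _≤?_ to _≤ᶠ?_)
open import Data.Fin.Properties using (any?; all?; injective⇒≤) renaming (≤-antisym to ≤ᶠ-antisym)
open import Data.Fin.Subset using (Subset; _∈_; _⊂_)
open import Data.Fin.Subset.Induction using (⊂-wellFounded)
open import Data.Bool using (Bool; true; false)
open import Data.Bool.Properties using () renaming (_≟_ to _≟ᵇ_)
open import Data.List using (List; []; _∷_; length; lookup)
import Data.List.Relation.Unary.All as All
open All using ([])
open import Data.List.Relation.Unary.All.Properties using (¬Any⇒All¬)
open import Data.List.Relation.Unary.Any using (here; there)
open import Data.List.Relation.Unary.AllPairs using ([]; _∷_)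
open import Data.List.Relation.Unary.Unique.Propositional using (Unique)
open import Data.List.Membership.Propositional using () renaming (_∈_ to _∈ˡ_)
open import Data.List.Membership.Propositional.Properties using (∈-lookup)
open import Data.Vec using (tabulate)
open import Data.Vec.Properties using (lookup∘tabulate; lookup⇒[]=; []=⇒lookup)
open import Data.Product using (∃; _×_; _,_; proj₁; proj₂)
open import Data.Sum using (_⊎_; inj₁; inj₂)
open import Function using (_∘_)
open import Induction.WellFounded using (Acc; acc)
open import Relation.Binary.Core using (_⇒_)
open import Relation.Binary.Definitions using () renaming (Decidable to Decidable₂)
open import Relation.Binary.Construct.Closure.ReflexiveTransitive using (Star; ε; _◅_; _◅◅_)
open import Relation.Binary.PropositionalEquality using (_≡_; _≢_; refl; sym; trans; cong)
open import Relation.Nullary using (¬_; Dec; yes; no; does; contradiction)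
open import Relation.Nullary.Decidable using (_×-dec_; _⊎-dec_; _→-dec_; ¬?; map′; dec-true; decidable-stable)
open import Relation.Unary using (Decidable)

from-does-true : ∀ {P : Set} (P? : Dec P) → does P? ≡ true → P
from-does-true (yes p) _ = p

lookup-injective : ∀ {A : Set} {xs : List A} → Unique xs →
  ∀ {i j} → lookup xs i ≡ lookup xs j → i ≡ j
lookup-injective (_ ∷ _) {fzero} {fzero} _ = refl
lookup-injective (x∉xs ∷ _) {fzero} {fsuc j} eq = contradiction eq (All.lookup x∉xs (∈-lookup j))
lookup-injective (x∉xs ∷ _) {fsuc i} {fzero} eq = contradiction (sym eq) (All.lookup x∉xs (∈-lookup i))
lookup-injective (_ ∷ xs-unique) {fsuc i} {fsuc j} eq = cong fsuc (lookup-injective xs-unique eq)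

length-unique≤ : ∀ {n} {xs : List (Fin n)} → Unique xs → length xs ≤ n
length-unique≤ {xs = xs} u = injective⇒≤ {f = lookup xs} (lookup-injective u)

least : ∀ {n} {P : Fin n → Set} → Decidable P → ∃ P → ∃ λ x → P x × (∀ y → P y → x ≤ᶠ y)
least {suc n} P? p with P? fzero
... | yes p₀ = fzero , p₀ , λ _ _ → z≤n
least {suc n} P? (fzero , p₀) | no ¬p₀ = contradiction p₀ ¬p₀
least {suc n} P? (fsuc i , pᵢ) | no ¬p₀ with least (P? ∘ fsuc) (i , pᵢ)
... | x , px , x-least = fsuc x , px , λ { fzero p₀ → contradiction p₀ ¬p₀ ; (fsuc y) py → s≤s (x-least y py) }

module _ {n : ℕ} {A B : ArcSet n} (A⇒B : A ⇒ B) where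

  mapPathSeq : ∀ {x y vs} → PathSeq A x y vs → PathSeq B x y vs
  mapPathSeq (here x) = here x
  mapPathSeq (step a p) = step (A⇒B a) (mapPathSeq p)

  mapPath : ∀ {x y} → Path A x y → Path B x y
  mapPath (vs , p , u) = vs , mapPathSeq p , u

  InV-mono : ∀ {v} → InV A v → InV B v
  InV-mono (w , inj₁ a) = w , inj₁ (A⇒B a)
  InV-mono (w , inj₂ a) = w , inj₂ (A⇒B a)

module KernelByPaths {n : ℕ} {A : ArcSet n} (A? : Decidable₂ A) where

  open import Data.List.Membership.DecPropositional (_≟_ {n}) using () renaming (_∈?_ to _∈ˡ?_)

  InV? : Decidable (InV A)
  InV? v = any? (λ w → A? v w ⊎-dec A? w v)

  InV-alongSeq : ∀ {x y vs} → InV A x → PathSeq A x y vs → InV A y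
  InV-alongSeq x∈V (here _) = x∈V
  InV-alongSeq _ (step {x} a p) = InV-alongSeq (x , inj₂ a) p

  InV-along : ∀ {x y} → InV A x → Path A x y → InV A y
  InV-along x∈V (_ , p , _) = InV-alongSeq x∈V p

  path-refl : ∀ {x} → Path A x x
  path-refl = _ , here _ , [] ∷ []

  suffixPath : ∀ {x y z ws} → PathSeq A y z ws → Unique ws → x ∈ˡ ws → Path A x z
  suffixPath p@(here _) u (here refl) = _ , p , u
  suffixPath p@(step _ _) u (here refl) = _ , p , u
  suffixPath (step _ p) (_ ∷ u) (there x∈ws) = suffixPath p u x∈ws

  prependArc : ∀ {x y z} → A x y → Path A y z → Path A x z
  prependArc {x} a (ws , p , u) with x ∈ˡ? ws
  ... | yes x∈ws = suffixPath p u x∈ws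
  ... | no x∉ws = x ∷ ws , step a p , ¬Any⇒All¬ ws x∉ws ∷ u

  walk⇒path : Star A ⇒ Path A
  walk⇒path ε = path-refl
  walk⇒path (a ◅ w) = prependArc a (walk⇒path w)

  pathSeq⇒walk : ∀ {x y vs} → PathSeq A x y vs → Star A x y
  pathSeq⇒walk (here _) = ε
  pathSeq⇒walk (step a p) = a ◅ pathSeq⇒walk p

  path-trans : ∀ {x y z} → Path A x y → Path A y z → Path A x z
  path-trans (_ , p , _) (_ , q , _) = walk⇒path (pathSeq⇒walk p ◅◅ pathSeq⇒walk q)

  ReachableWithin : ℕ → Fin n → Fin n → Set
  ReachableWithin zero x y = x ≡ y
  ReachableWithin (suc k) x y = x ≡ y ⊎ ∃ λ z → A x z × ReachableWithin k z y

  reachableWithin? : ∀ k → Decidable₂ (ReachableWithin k)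
  reachableWithin? zero x y = x ≟ y
  reachableWithin? (suc k) x y = (x ≟ y) ⊎-dec any? (λ z → A? x z ×-dec reachableWithin? k z y)

  reachableWithin⇒walk : ∀ k → ReachableWithin k ⇒ Star A
  reachableWithin⇒walk zero refl = ε
  reachableWithin⇒walk (suc k) (inj₁ refl) = ε
  reachableWithin⇒walk (suc k) (inj₂ (_ , a , r)) = a ◅ reachableWithin⇒walk k r

  pathSeq⇒reachableWithin : ∀ k {x y vs} → PathSeq A x y vs → length vs ≤ suc k → ReachableWithin k x y
  pathSeq⇒reachableWithin zero (here _) _ = refl
  pathSeq⇒reachableWithin (suc k) (here _) _ = inj₁ refl
  pathSeq⇒reachableWithin zero (step _ (here _)) (s≤s ())
  pathSeq⇒reachableWithin zero (step _ (step _ _)) (s≤s ())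
  pathSeq⇒reachableWithin (suc k) (step a p) (s≤s ≤k) = inj₂ (_ , a , pathSeq⇒reachableWithin k p ≤k)

  path? : Decidable₂ (Path A)
  path? x y = map′ (walk⇒path ∘ reachableWithin⇒walk n) reachable (reachableWithin? n x y)
    where
    reachable : Path A x y → ReachableWithin n x y
    reachable (_ , p , u) = pathSeq⇒reachableWithin n p (m≤n⇒m≤1+n (length-unique≤ u))

  Terminal : Fin n → Set
  Terminal t = ∀ z → Path A t z → Path A z t

  terminal? : Decidable Terminal
  terminal? t = all? (λ z → path? t z →-dec path? z t)

  reachSet : Fin n → Subset n
  reachSet v = tabulate (does ∘ path? v)

  ∈-reachSet⁺ : ∀ {v x} → Path A v x → x ∈ reachSet v
  ∈-reachSet⁺ {v} {x} p = lookup⇒[]= x _ (trans (lookup∘tabulate _ x) (dec-true (path? v x) p))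

  ∈-reachSet⁻ : ∀ {v x} → x ∈ reachSet v → Path A v x
  ∈-reachSet⁻ {v} {x} x∈ = from-does-true (path? v x) (trans (sym (lookup∘tabulate _ x)) ([]=⇒lookup x∈))

  reachSet-⊂ : ∀ {v z} → Path A v z → ¬ Path A z v → reachSet z ⊂ reachSet v
  reachSet-⊂ v⇝z ¬z⇝v =
    (λ x∈ → ∈-reachSet⁺ (path-trans v⇝z (∈-reachSet⁻ x∈))) ,
    _ , ∈-reachSet⁺ path-refl , ¬z⇝v ∘ ∈-reachSet⁻

  reaches-terminal : ∀ v → ∃ λ t → Path A v t × Terminal t
  reaches-terminal v = go v (⊂-wellFounded (reachSet v))
    where
    go : ∀ v → Acc _⊂_ (reachSet v) → ∃ λ t → Path A v t × Terminal t
    go v (acc rs) with any? (λ z → path? v z ×-dec ¬? (path? z v))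
    ... | no ¬escape = v , path-refl , λ z v⇝z → decidable-stable (path? z v) (λ ¬z⇝v → ¬escape (z , v⇝z , ¬z⇝v))
    ... | yes (z , v⇝z , ¬z⇝v) with go z (rs (reachSet-⊂ v⇝z ¬z⇝v))
    ...   | t , z⇝t , t-terminal = t , path-trans v⇝z z⇝t , t-terminal

  module _ {g : Fin n → Set} (g? : Decidable g) where

    Representative : Fin n → Set
    Representative v = InV A v × g v × Terminal v × (∀ u → g u → Path A v u → v ≤ᶠ u)

    representative? : Decidable Representative
    representative? v =
      InV? v ×-dec g? v ×-dec terminal? v ×-dec all? (λ u → g? u →-dec path? v u →-dec (v ≤ᶠ? u))

    representatives-unlinked : ∀ {x y} → Representative x → Representative y → Path A x y → x ≡ y
    representatives-unlinked (_ , gx , x-terminal , x-least) (_ , gy , _ , y-least) x⇝y =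
      ≤ᶠ-antisym (x-least _ gy x⇝y) (y-least _ gx (x-terminal _ x⇝y))

    reaches-representative : (∀ v → InV A v → ∃ λ w → g w × Path A v w) →
      ∀ v → InV A v → ∃ λ u → Representative u × Path A v u
    reaches-representative reaches-g v v∈V with reaches-terminal v
    ... | t , v⇝t , t-terminal with reaches-g t (InV-along v∈V v⇝t)
    ... | w , gw , t⇝w with least (λ u → g? u ×-dec path? t u) (w , gw , t⇝w)
    ... | u , (gu , t⇝u) , u-least =
      u , (InV-along v∈V (path-trans v⇝t t⇝u) , gu , u-terminal , λ u′ gu′ u⇝u′ → u-least u′ (gu′ , path-trans t⇝u u⇝u′)) ,
      path-trans v⇝t t⇝u
      where
      u-terminal : Terminal u
      u-terminal z u⇝z = path-trans (t-terminal z (path-trans t⇝u u⇝z)) t⇝u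

    kernelByPaths-inside : (∀ v → InV A v → ∃ λ w → g w × Path A v w) →
      ∃ λ N → IsKernelByPaths A N × (∀ v → N v ≡ true → g v)
    kernelByPaths-inside reaches-g = N , (N⊆V , N-independent , N-absorbing) , λ _ → proj₁ ∘ proj₂ ∘ isRepresentative
      where
      N : Fin n → Bool
      N v = does (representative? v)
      isRepresentative : ∀ {v} → N v ≡ true → Representative v
      isRepresentative = from-does-true (representative? _)
      N⊆V : ∀ v → N v ≡ true → InV A v
      N⊆V v = proj₁ ∘ isRepresentative
      N-independent : ∀ x y → N x ≡ true → N y ≡ true → x ≢ y → ¬ Path A x y
      N-independent x y Nx Ny x≢y = x≢y ∘ representatives-unlinked (isRepresentative Nx) (isRepresentative Ny)
      N-absorbing : ∀ v → InV A v → N v ≡ false → ∃ λ w → N w ≡ true × Path A v w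
      N-absorbing v v∈V _ with reaches-representative reaches-g v v∈V
      ... | u , u-rep , v⇝u = u , dec-true (representative? u) u-rep , v⇝u

module _ {n h m : ℕ} (adj : Fin n → Fin n → Bool) (Hadj : Fin h → Fin h → Bool)
         (ρ : Fin n → Fin n → Fin h) (cls : Fin n → Fin n → Fin m) where

  private
    Class : Fin m → ArcSet n
    Class = ClassArcs adj Hadj ρ cls

    _⟶_ : Fin m → Fin m → Set
    _⟶_ = CArc adj Hadj ρ cls

  class? : ∀ i → Decidable₂ (Class i)
  class? i u v = (adj u v ≟ᵇ true) ×-dec (cls u v ≟ i)

  carc? : Decidable₂ _⟶_
  carc? i j = any? λ u → any? λ v → any? λ w → class? i u v ×-dec class? j v w

  unionArcs? : ∀ S → Decidable₂ (UnionArcs adj Hadj ρ cls S)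
  unionArcs? S u v = (adj u v ≟ᵇ true) ×-dec (S (cls u v) ≟ᵇ true)

  inOutNbhd? : ∀ S → Decidable (InOutNbhd adj Hadj ρ cls S)
  inOutNbhd? S j = (S j ≟ᵇ false) ×-dec any? (λ i → (S i ≟ᵇ true) ×-dec carc? i j)

  nbhdUnionArcs? : ∀ S → Decidable₂ (NbhdUnionArcs adj Hadj ρ cls S)
  nbhdUnionArcs? S u v = (adj u v ≟ᵇ true) ×-dec inOutNbhd? S (cls u v)

  nonSink⇒properOutNeighbour : ∀ {i} → ¬ IsSink adj Hadj ρ cls i → ∃ λ j → i ⟶ j × i ≢ j
  nonSink⇒properOutNeighbour {i} ¬sink with any? (λ j → carc? i j ×-dec ¬? (i ≟ j))
  ... | yes found = found
  ... | no ¬found = contradiction (λ j i⟶j → decidable-stable (i ≟ j) (λ i≢j → ¬found (j , i⟶j , i≢j))) ¬sink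

  class⇒unionArcs : ∀ {S i} → S i ≡ true → Class i ⇒ UnionArcs adj Hadj ρ cls S
  class⇒unionArcs {S} Si (a , refl) = a , Si

  class⇒nbhdUnionArcs : ∀ {S j} → InOutNbhd adj Hadj ρ cls S j → Class j ⇒ NbhdUnionArcs adj Hadj ρ cls S
  class⇒nbhdUnionArcs j∈N⁺ (a , refl) = a , j∈N⁺

  InV-unionArcs : ∀ {S v} → InV (UnionArcs adj Hadj ρ cls S) v → ∃ λ i → S i ≡ true × InV (Class i) v
  InV-unionArcs {v = v} (w , inj₁ (a , Si)) = cls v w , Si , w , inj₁ (a , refl)
  InV-unionArcs {v = v} (w , inj₂ (a , Si)) = cls w v , Si , w , inj₂ (a , refl)

  reaches-outNbhd : WalkPreservative adj Hadj ρ cls → (∀ i → ¬ IsSink adj Hadj ρ cls i) →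
    ∀ S → Independent adj Hadj ρ cls S →
    ∀ v → InV (UnionArcs adj Hadj ρ cls S) v →
    ∃ λ w → InV (NbhdUnionArcs adj Hadj ρ cls S) w × Path (UnionArcs adj Hadj ρ cls S) v w
  reaches-outNbhd walkPreservative noSink S independent v v∈V
    with InV-unionArcs v∈V
  ... | i , Si , v∈Vi with nonSink⇒properOutNeighbour (noSink i)
  ... | j , i⟶j , i≢j with S j in Sj
  ... | true = contradiction i⟶j (independent i j Si Sj i≢j)
  ... | false with walkPreservative i j i⟶j v v∈Vi
  ... | w , w∈Vj , v⇝w =
    w , InV-mono {A = Class j} (class⇒nbhdUnionArcs (Sj , i , Si , i⟶j)) w∈Vj ,
    mapPath {A = Class i} (class⇒unionArcs Si) v⇝w

proposition2 : {n h m : ℕ}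
    (adj : Fin n → Fin n → Bool) (Hadj : Fin h → Fin h → Bool)
    (ρ : Fin n → Fin n → Fin h) (cls : Fin n → Fin n → Fin m) →
    (∀ v → adj v v ≡ false) →
    IsHClassPartition adj Hadj ρ cls →
    2 ≤ m →
    WalkPreservative adj Hadj ρ cls →
    (∀ i → ¬ IsSink adj Hadj ρ cls i) →
    (S : Fin m → Bool) → Independent adj Hadj ρ cls S →
    ∃ λ (N : Fin n → Bool) →
      IsKernelByPaths (UnionArcs adj Hadj ρ cls S) N
      × (∀ v → N v ≡ true → InV (NbhdUnionArcs adj Hadj ρ cls S) v)
proposition2 adj Hadj ρ cls _ _ _ walkPreservative noSink S independent =
  kernelByPaths-inside (KernelByPaths.InV? (nbhdUnionArcs? adj Hadj ρ cls S))
    (reaches-outNbhd adj Hadj ρ cls walkPreservative noSink S independent)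
  where open KernelByPaths (unionArcs? adj Hadj ρ cls S)
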